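{- For any instance of $P|outtree,p_j=1|\sum wC$ and any feasible schedule $\sigma$, $cost^f(\sigma)\le cost(\sigma)$.
   Context: Instances, schedules and cost. - An instance consists of a finite set $\mathcal{T}$ of tasks with nonnegative weights $w(j)$, and $P$ machines. - Each task has at most one parent task, with no cycles in the parent relation. - A feasible schedule processes every task exactly once at some time step $1,2,\dots$, at most $P$ tasks per time step, each task strictly after its parent. - $cost(\sigma)=\sum_j w(j)c(\sigma,j)$, where $c(\sigma,j)$ is the time step at which $j$ is processed. Subtrees and densities. - A subtree of $\mathcal{T}$ is a set of tasks with a single root task such that the parent of every non-root task in the set also lies in the set. - Its weight $w(\cdot)$ is the total weight of its tasks, its size $s(\cdot)$ is the number of its tasks, and its density is weight divided by size. - For each task $j$, let $F_j$ be a (fixed) subtree of maximum density among subtrees rooted at $j$. Horn's trees. Start with all tasks remaining. Repeatedly pick a remaining task $j$ whose parent is not remaining (or which has no parent), declare $F_j$ a Horn's tree, and remove its tasks, until none remain. The Horn's trees partition the tasks; denote them by $\mathcal{H}$. Fractional cost. For a Horn's tree $T_i$ and time step $t$, let $U_i^t(\sigma)$ be the set of tasks of $T_i$ not processed during steps $1,\dots,t-1$. Define $$cost^f(\sigma)=\sum_{t\ge1}\sum_{T_i\in\mathcal{H}}|U_i^t(\sigma)|\,\frac{w(T_i)}{s(T_i)}.$$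
   Formalization: The weights $w(j)$ take values in the nonnegative rationals. -}

module Defs where

open import Data.Nat as ℕ using (ℕ; zero; suc; _⊔_)
open import Data.Fin using (Fin)
import Data.Fin as Fin
open import Data.Fin.Subset using (Subset; _∈_; _∉_; _─_; ∣_∣; ⊥; ⊤)
open import Data.Fin.Subset.Properties using (_∈?_)
open import Data.Maybe using (Maybe; just; nothing; _>>=_)
open import Data.Integer using (+_)
open import Data.Rational using (ℚ; 0ℚ; _+_; _*_; _≤_; _/_)
open import Data.Product using (Σ; _×_; ∃)
open import Data.Sum using (_⊎_)
open import Data.List using (List; []; _∷_)
open import Relation.Nullary using (¬_; does)
open import Relation.Binary.PropositionalEquality using (_≡_; _≢_)
open import Data.Bool using (Bool; if_then_else_; _∧_)

sumFin : ∀ {n} → (Fin n → ℚ) → ℚ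
sumFin {zero}  f = 0ℚ
sumFin {suc n} f = f Fin.zero + sumFin (λ i → f (Fin.suc i))

-- Σ over t = 1 .. T
sumSteps : ℕ → (ℕ → ℚ) → ℚ
sumSteps zero    f = 0ℚ
sumSteps (suc T) f = sumSteps T f + f (suc T)

maxFin : ∀ {n} → (Fin n → ℕ) → ℕ
maxFin {zero}  f = 0
maxFin {suc n} f = f Fin.zero ⊔ maxFin (λ i → f (Fin.suc i))

ℕtoℚ : ℕ → ℚ
ℕtoℚ k = + k / 1

ancestor : ∀ {n} → (Fin n → Maybe (Fin n)) → ℕ → Fin n → Maybe (Fin n)
ancestor par zero    j = just j
ancestor par (suc k) j = ancestor par k j >>= par

Acyclic : ∀ {n} → (Fin n → Maybe (Fin n)) → Set
Acyclic par = ∀ j k → ancestor par (suc k) j ≢ just j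

IsSubtree : ∀ {n} → (Fin n → Maybe (Fin n)) → Fin n → Subset n → Set
IsSubtree par r S =
  r ∈ S × (∀ k → k ∈ S → k ≢ r → Σ _ λ p → par k ≡ just p × p ∈ S)

weight : ∀ {n} → (Fin n → ℚ) → Subset n → ℚ
weight w S = sumFin (λ k → if does (k ∈? S) then w k else 0ℚ)

size : ∀ {n} → Subset n → ℕ
size S = ∣ S ∣

-- 1/s (only used for s ≥ 1; value 0 at s = 0 is irrelevant)
invℕ : ℕ → ℚ
invℕ zero    = 0ℚ
invℕ (suc s) = + 1 / suc s

density : ∀ {n} → (Fin n → ℚ) → Subset n → ℚ
density w S = weight w S * invℕ (size S)

IsMaxDensityChoice : ∀ {n} → (Fin n → Maybe (Fin n)) → (Fin n → ℚ) →
                     (Fin n → Subset n) → Set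
IsMaxDensityChoice par w F =
  ∀ j → IsSubtree par j (F j) ×
        (∀ S → IsSubtree par j S → density w S ≤ density w (F j))

-- Horn's procedure: HornRun par F R js means that, starting with the set
-- R of remaining tasks, successively picking the roots js (each remaining,
-- with parent absent or not remaining), declaring F j a Horn's tree and
-- removing its tasks, ends with no tasks remaining.

data HornRun {n} (par : Fin n → Maybe (Fin n)) (F : Fin n → Subset n) :
             Subset n → List (Fin n) → Set where
  done : ∀ {R} → R ≡ ⊥ → HornRun par F R []
  step : ∀ {R j js} → j ∈ R →
         (par j ≡ nothing ⊎ Σ _ λ p → par j ≡ just p × p ∉ R) →
         HornRun par F (R ─ F j) js →
         HornRun par F R (j ∷ js)

countFin : ∀ {n} → (Fin n → Bool) → ℕ
countFin {zero}  f = 0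
countFin {suc n} f = (if f Fin.zero then 1 else 0) ℕ.+ countFin (λ i → f (Fin.suc i))

load : ∀ {n} → (Fin n → ℕ) → ℕ → ℕ
load σ t = countFin (λ j → does (σ j ℕ.≟ t))

-- feasible schedule on P machines: σ j is the time step (≥ 1) of task j
Feasible : ∀ {n} → ℕ → (Fin n → Maybe (Fin n)) → (Fin n → ℕ) → Set
Feasible P par σ =
  (∀ j → 1 ℕ.≤ σ j) ×
  (∀ t → load σ t ℕ.≤ P) ×
  (∀ j p → par j ≡ just p → σ p ℕ.< σ j)

cost : ∀ {n} → (Fin n → ℚ) → (Fin n → ℕ) → ℚ
cost w σ = sumFin (λ j → w j * ℕtoℚ (σ j))

-- |U_i^t|: tasks of T not processed during steps 1..t-1
unprocessed : ∀ {n} → (Fin n → ℕ) → Subset n → ℕ → ℕ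
unprocessed σ T t = countFin (λ k → does (k ∈? T) ∧ does (t ℕ.≤? σ k))

sumList : ∀ {A : Set} → (A → ℚ) → List A → ℚ
sumList f []       = 0ℚ
sumList f (x ∷ xs) = f x + sumList f xs

-- fractional cost w.r.t. the Horn's trees H (given as list of subsets).
-- The sum over t ≥ 1 is truncated at the makespan max_j σ j, since all
-- later terms vanish (U_i^t = ∅ for t > max_j σ j).
costf : ∀ {n} → (Fin n → ℚ) → List (Subset n) → (Fin n → ℕ) → ℚ
costf w H σ =
  sumSteps (maxFin σ) (λ t →
    sumList (λ T → ℕtoℚ (unprocessed σ T t) * density w T) H)

-- Fix a Horn's tree T = F j of density ρ and a time step t. The tasks of T processed before t
-- are either none or, since parents are processed first, a subtree rooted at j; maximality of
-- F j bounds their weight by ρ times their number. As w(T) = ρ |T|, the unprocessed part U of T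
-- satisfies ρ |U| ≤ w(U). Summing over t turns Σ_t w(U) into Σ_{k ∈ T} w k σ k, and Horn's trees
-- partition the tasks, so summing over the trees gives cost σ.
module Submission where

open import Defs
open import Data.Nat using (ℕ)
open import Data.Fin using (Fin)
open import Data.Fin.Subset using (Subset; ⊤)
open import Data.Maybe using (Maybe)
open import Data.List using (List; map)
open import Data.Rational using (ℚ; 0ℚ; _≤_)

open import Algebra using (CommutativeMonoid)
open import Data.Bool using (Bool; true; false; if_then_else_; _∧_; not)
open import Data.Bool.Properties using (∧-zeroʳ)
open import Data.Fin using (zero; suc; _≟_)
open import Data.Fin.Subset using (_∈_; _∉_; _⊆_; _─_; ⊥; inside; outside)
open import Data.Fin.Subset.Properties
  using (_∈?_; ∈⊤; ∉⊥; Empty-unique; ∣⊥∣≡0; p─q⊆p; x∈p∧x∉q⇒x∈p─q; x∈p⇒∣p-x∣<∣p∣)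
import Data.Integer as ℤ
import Data.Integer.Properties as ℤ
open import Data.List using ([]; _∷_)
open import Data.Maybe using (just; nothing)
open import Data.Maybe.Properties using (just-injective)
open import Data.Nat as ℕ using (zero; suc; _⊓_; _<_)
import Data.Nat.Coprimality as Coprime
open import Data.Nat.Induction using (<-wellFounded)
import Data.Nat.Properties as ℕ
open import Data.Product using (Σ; _×_; _,_; proj₁; proj₂; uncurry)
open import Data.Rational using (1ℚ; _+_; _*_; -_; mkℚ; NonNegative; toℚᵘ)
import Data.Rational.Properties as ℚ
import Data.Rational.Unnormalised as ℚᵘ
import Data.Rational.Unnormalised.Properties as ℚᵘ
open import Data.Sum using (_⊎_; inj₁; inj₂)
open import Data.Vec using ([]; _∷_; here; there; lookup; tabulate)
open import Data.Vec.Properties using (lookup∘tabulate)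
open import Function using (_∘_; _⇔_; mk⇔; Equivalence)
open import Induction.WellFounded using (Acc; acc)
open import Level using (0ℓ)
open import Relation.Binary.PropositionalEquality
open import Relation.Nullary using (¬_; Dec; yes; no; does; _×-dec_; ¬?; contradiction)
open import Relation.Nullary.Decidable using (dec-true; dec-false; does-⇔)
open import Relation.Unary using (Pred; Decidable)

open import Algebra.Properties.CommutativeSemigroup
  (CommutativeMonoid.commutativeSemigroup ℚ.+-0-commutativeMonoid) using (interchange)
open import Algebra.Properties.Group ℚ.+-0-group using (//-rightDividesʳ)

-- ℕtoℚ k is fromℚᵘ (k / 1) by definition, so additivity is transported from ℚᵘ.
ℕtoℚ-+ : ∀ a b → ℕtoℚ (a ℕ.+ b) ≡ ℕtoℚ a + ℕtoℚ b
ℕtoℚ-+ a b = ℚ.toℚᵘ-injective (begin-equality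
  toℚᵘ (ℕtoℚ (a ℕ.+ b))            ≃⟨ ℚ.toℚᵘ-fromℚᵘ (asℚᵘ (a ℕ.+ b)) ⟩
  asℚᵘ (a ℕ.+ b)                   ≃⟨ ℚᵘ.≃-reflexive (cong (λ i → ℚᵘ.mkℚᵘ i 0) numerators) ⟩
  asℚᵘ a ℚᵘ.+ asℚᵘ b               ≃⟨ ℚᵘ.+-cong (ℚ.toℚᵘ-fromℚᵘ (asℚᵘ a)) (ℚ.toℚᵘ-fromℚᵘ (asℚᵘ b)) ⟨
  toℚᵘ (ℕtoℚ a) ℚᵘ.+ toℚᵘ (ℕtoℚ b) ≃⟨ ℚ.toℚᵘ-homo-+ (ℕtoℚ a) (ℕtoℚ b) ⟨
  toℚᵘ (ℕtoℚ a + ℕtoℚ b)           ∎)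
  where
  open ℚᵘ.≤-Reasoning
  asℚᵘ : ℕ → ℚᵘ.ℚᵘ
  asℚᵘ k = ℚᵘ.mkℚᵘ (ℤ.+ k) 0
  numerators : ℤ.+ (a ℕ.+ b) ≡ ℤ._+_ (ℤ.+ a ℤ.* ℤ.+ 1) (ℤ.+ b ℤ.* ℤ.+ 1)
  numerators = trans (ℤ.pos-+ a b)
                     (sym (cong₂ ℤ._+_ (ℤ.*-identityʳ (ℤ.+ a)) (ℤ.*-identityʳ (ℤ.+ b))))

ℕtoℚ-nonNeg : ∀ k → NonNegative (ℕtoℚ k)
ℕtoℚ-nonNeg k = ℚ.normalize-nonNeg k 1

invℕ-inverseˡ : ∀ s → invℕ (suc s) * ℕtoℚ (suc s) ≡ 1ℚ
invℕ-inverseˡ s = trans (cong₂ _*_ (ℚ.normalize-coprime (Coprime.1-coprimeTo (suc s)))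
                                   (ℚ.normalize-coprime s+1⊥1))
                        (ℚ.*-inverseˡ (mkℚ ℤ.+[1+ s ] 0 s+1⊥1))
  where
  s+1⊥1 : Coprime.Coprime (suc s) 1
  s+1⊥1 = Coprime.sym (Coprime.1-coprimeTo (suc s))

ℕtoℚ-*-invℕ : ∀ W s → 0 < s → ℕtoℚ s * (W * invℕ s) ≡ W
ℕtoℚ-*-invℕ W (suc s) _ = begin
  ℕtoℚ (suc s) * (W * invℕ (suc s)) ≡⟨ ℚ.*-comm (ℕtoℚ (suc s)) _ ⟩
  W * invℕ (suc s) * ℕtoℚ (suc s)   ≡⟨ ℚ.*-assoc W _ _ ⟩
  W * (invℕ (suc s) * ℕtoℚ (suc s)) ≡⟨ cong (W *_) (invℕ-inverseˡ s) ⟩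
  W * 1ℚ                            ≡⟨ ℚ.*-identityʳ W ⟩
  W                                 ∎
  where open ≡-Reasoning

+-cancelʳ-≤ : ∀ c {x y} → x + c ≤ y + c → x ≤ y
+-cancelʳ-≤ c {x} {y} x+c≤y+c =
  subst₂ _≤_ (//-rightDividesʳ c x) (//-rightDividesʳ c y) (ℚ.+-monoˡ-≤ (- c) x+c≤y+c)

sumFin-cong : ∀ {n} {f g : Fin n → ℚ} → (∀ k → f k ≡ g k) → sumFin f ≡ sumFin g
sumFin-cong {zero}  f≗g = refl
sumFin-cong {suc n} f≗g = cong₂ _+_ (f≗g zero) (sumFin-cong (f≗g ∘ suc))

sumFin-zero : ∀ n → sumFin {n} (λ _ → 0ℚ) ≡ 0ℚ
sumFin-zero zero    = refl
sumFin-zero (suc n) = cong (0ℚ +_) (sumFin-zero n)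

sumFin-+ : ∀ {n} (f g : Fin n → ℚ) → sumFin (λ k → f k + g k) ≡ sumFin f + sumFin g
sumFin-+ {zero}  f g = refl
sumFin-+ {suc n} f g = trans (cong (f zero + g zero +_) (sumFin-+ (f ∘ suc) (g ∘ suc)))
                             (interchange (f zero) (g zero) (sumFin (f ∘ suc)) (sumFin (g ∘ suc)))

sumSteps-zero : ∀ M → sumSteps M (λ _ → 0ℚ) ≡ 0ℚ
sumSteps-zero zero    = refl
sumSteps-zero (suc M) = cong (_+ 0ℚ) (sumSteps-zero M)

sumSteps-+ : ∀ M (f g : ℕ → ℚ) → sumSteps M (λ t → f t + g t) ≡ sumSteps M f + sumSteps M g
sumSteps-+ zero    f g = refl
sumSteps-+ (suc M) f g = trans (cong (_+ (f (suc M) + g (suc M))) (sumSteps-+ M f g))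
                               (interchange (sumSteps M f) (sumSteps M g) (f (suc M)) (g (suc M)))

sumSteps-mono : ∀ M {f g : ℕ → ℚ} → (∀ t → f t ≤ g t) → sumSteps M f ≤ sumSteps M g
sumSteps-mono zero    f≤g = ℚ.≤-refl
sumSteps-mono (suc M) f≤g = ℚ.+-mono-≤ (sumSteps-mono M f≤g) (f≤g (suc M))

sumSteps-sumFin : ∀ M {n} (h : Fin n → ℕ → ℚ) →
                  sumSteps M (λ t → sumFin (λ k → h k t)) ≡ sumFin (λ k → sumSteps M (h k))
sumSteps-sumFin M {zero}  h = sumSteps-zero M
sumSteps-sumFin M {suc n} h = trans (sumSteps-+ M (h zero) _)
                                    (cong (sumSteps M (h zero) +_) (sumSteps-sumFin M (h ∘ suc)))

sumSteps-sumList : ∀ M {A : Set} (h : A → ℕ → ℚ) xs →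
                   sumSteps M (λ t → sumList (λ x → h x t) xs) ≡ sumList (λ x → sumSteps M (h x)) xs
sumSteps-sumList M h []       = sumSteps-zero M
sumSteps-sumList M h (x ∷ xs) = trans (sumSteps-+ M (h x) _)
                                      (cong (sumSteps M (h x) +_) (sumSteps-sumList M h xs))

sumList-map : ∀ {A B : Set} (f : B → ℚ) (g : A → B) xs → sumList f (map g xs) ≡ sumList (f ∘ g) xs
sumList-map f g []       = refl
sumList-map f g (x ∷ xs) = cong (f (g x) +_) (sumList-map f g xs)

sumList-mono : ∀ {A : Set} {f g : A → ℚ} → (∀ x → f x ≤ g x) → ∀ xs → sumList f xs ≤ sumList g xs
sumList-mono f≤g []       = ℚ.≤-refl
sumList-mono f≤g (x ∷ xs) = ℚ.+-mono-≤ (f≤g x) (sumList-mono f≤g xs)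

sumSteps-indicator : ∀ M s c →
                     sumSteps M (λ t → if does (t ℕ.≤? s) then c else 0ℚ) ≡ c * ℕtoℚ (M ⊓ s)
sumSteps-indicator zero    s c = sym (ℚ.*-zeroʳ c)
sumSteps-indicator (suc M) s c = add-term (suc M ℕ.≤? s)
  where
  open ≡-Reasoning
  earlier : ℚ
  earlier = sumSteps M (λ t → if does (t ℕ.≤? s) then c else 0ℚ)

  add-term : (d : Dec (suc M ℕ.≤ s)) → earlier + (if does d then c else 0ℚ) ≡ c * ℕtoℚ (suc M ⊓ s)
  add-term (yes M<s) = begin
    earlier + c                ≡⟨ cong (_+ c) (sumSteps-indicator M s c) ⟩
    c * ℕtoℚ (M ⊓ s) + c       ≡⟨ cong (λ m → c * ℕtoℚ m + c) (ℕ.m≤n⇒m⊓n≡m (ℕ.<⇒≤ M<s)) ⟩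
    c * ℕtoℚ M + c             ≡⟨ ℚ.+-comm _ c ⟩
    c + c * ℕtoℚ M             ≡⟨ cong (_+ c * ℕtoℚ M) (ℚ.*-identityʳ c) ⟨
    c * 1ℚ + c * ℕtoℚ M        ≡⟨ ℚ.*-distribˡ-+ c 1ℚ (ℕtoℚ M) ⟨
    c * (1ℚ + ℕtoℚ M)          ≡⟨ cong (c *_) (ℕtoℚ-+ 1 M) ⟨
    c * ℕtoℚ (suc M)           ≡⟨ cong (λ m → c * ℕtoℚ m) (ℕ.m≤n⇒m⊓n≡m M<s) ⟨
    c * ℕtoℚ (suc M ⊓ s)       ∎
  add-term (no M≮s) = begin
    earlier + 0ℚ               ≡⟨ ℚ.+-identityʳ earlier ⟩
    earlier                    ≡⟨ sumSteps-indicator M s c ⟩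
    c * ℕtoℚ (M ⊓ s)           ≡⟨ cong (λ m → c * ℕtoℚ m) (ℕ.m≥n⇒m⊓n≡n s≤M) ⟩
    c * ℕtoℚ s                 ≡⟨ cong (λ m → c * ℕtoℚ m) (ℕ.m≥n⇒m⊓n≡n (ℕ.m≤n⇒m≤1+n s≤M)) ⟨
    c * ℕtoℚ (suc M ⊓ s)       ∎
    where
    s≤M : s ℕ.≤ M
    s≤M = ℕ.≤-pred (ℕ.≰⇒> M≮s)

maxFin-upperBound : ∀ {n} (f : Fin n → ℕ) k → f k ℕ.≤ maxFin f
maxFin-upperBound f zero    = ℕ.m≤m⊔n _ _
maxFin-upperBound f (suc k) = ℕ.≤-trans (maxFin-upperBound (f ∘ suc) k) (ℕ.m≤n⊔m _ _)

sumWhere : ∀ {n} → (Fin n → Bool) → (Fin n → ℚ) → ℚ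
sumWhere b v = sumFin (λ k → if b k then v k else 0ℚ)

sumWhere-cong : ∀ {n} {b c : Fin n → Bool} → (∀ k → b k ≡ c k) → ∀ v → sumWhere b v ≡ sumWhere c v
sumWhere-cong b≗c v = sumFin-cong (λ k → cong (λ x → if x then v k else 0ℚ) (b≗c k))

sumWhere-split : ∀ {n} (b c : Fin n → Bool) v →
                 sumWhere b v ≡ sumWhere (λ k → b k ∧ c k) v + sumWhere (λ k → b k ∧ not (c k)) v
sumWhere-split b c v = trans (sumFin-cong (λ k → split (b k) (c k) (v k)))
                             (sumFin-+ (λ k → if b k ∧ c k then v k else 0ℚ)
                                       (λ k → if b k ∧ not (c k) then v k else 0ℚ))
  where
  split : ∀ x y z →
          (if x then z else 0ℚ) ≡ (if x ∧ y then z else 0ℚ) + (if x ∧ not y then z else 0ℚ)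
  split true  true  z = sym (ℚ.+-identityʳ z)
  split true  false z = sym (ℚ.+-identityˡ z)
  split false y     z = refl

countFin-ℚ : ∀ {n} (b : Fin n → Bool) → ℕtoℚ (countFin b) ≡ sumWhere b (λ _ → 1ℚ)
countFin-ℚ {zero}  b = refl
countFin-ℚ {suc n} b = trans (ℕtoℚ-+ (if b zero then 1 else 0) (countFin (b ∘ suc)))
                             (cong₂ _+_ (indicator (b zero)) (countFin-ℚ (b ∘ suc)))
  where
  indicator : ∀ x → ℕtoℚ (if x then 1 else 0) ≡ (if x then 1ℚ else 0ℚ)
  indicator true  = refl
  indicator false = refl

layer-cake : ∀ {n} M (σ : Fin n → ℕ) → (∀ k → σ k ℕ.≤ M) → ∀ b v →
             sumSteps M (λ t → sumWhere (λ k → b k ∧ does (t ℕ.≤? σ k)) v) ≡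
             sumWhere b (λ k → v k * ℕtoℚ (σ k))
layer-cake M σ σ≤M b v =
  trans (sumSteps-sumFin M (λ k t → if b k ∧ does (t ℕ.≤? σ k) then v k else 0ℚ))
        (sumFin-cong column)
  where
  column : ∀ k → sumSteps M (λ t → if b k ∧ does (t ℕ.≤? σ k) then v k else 0ℚ) ≡
                 (if b k then v k * ℕtoℚ (σ k) else 0ℚ)
  column k with b k
  ... | true  = trans (sumSteps-indicator M (σ k) (v k))
                      (cong (λ m → v k * ℕtoℚ m) (ℕ.m≥n⇒m⊓n≡n (σ≤M k)))
  ... | false = sumSteps-zero M

does≡true⇒ : ∀ {A : Set} (a? : Dec A) → does a? ≡ true → A
does≡true⇒ (yes a) _ = a

does-∈? : ∀ {n} (k : Fin n) (S : Subset n) → does (k ∈? S) ≡ lookup S k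
does-∈? zero    (inside  ∷ S) = refl
does-∈? zero    (outside ∷ S) = refl
does-∈? (suc k) (_       ∷ S) = does-∈? k S

x∈p─q⇒x∉q : ∀ {n} {x : Fin n} (p q : Subset n) → x ∈ p ─ q → x ∉ q
x∈p─q⇒x∉q (inside ∷ p) (outside ∷ q) here                    = λ ()
x∈p─q⇒x∉q (_      ∷ p) (_       ∷ q) (there x∈p─q) (there x∈q) = x∈p─q⇒x∉q p q x∈p─q x∈q

does-∈?-─ : ∀ {n} (k : Fin n) (R S : Subset n) →
            does (k ∈? R ─ S) ≡ does (k ∈? R) ∧ not (does (k ∈? S))
does-∈?-─ k R S =
  does-⇔ (mk⇔ (λ k∈R─S → p─q⊆p R S k∈R─S , x∈p─q⇒x∉q R S k∈R─S) (uncurry x∈p∧x∉q⇒x∈p─q))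
         (k ∈? R ─ S) (k ∈? R ×-dec ¬? (k ∈? S))

subsetOf : ∀ {n} {P : Pred (Fin n) 0ℓ} → Decidable P → Subset n
subsetOf P? = tabulate (λ k → does (P? k))

does-∈?-subsetOf : ∀ {n} {P : Pred (Fin n) 0ℓ} (P? : Decidable P) k →
                   does (k ∈? subsetOf P?) ≡ does (P? k)
does-∈?-subsetOf P? k = trans (does-∈? k (subsetOf P?)) (lookup∘tabulate _ k)

∈-subsetOf : ∀ {n} {P : Pred (Fin n) 0ℓ} (P? : Decidable P) {k} → k ∈ subsetOf P? ⇔ P k
∈-subsetOf P? {k} = mk⇔
  (λ k∈ → does≡true⇒ (P? k) (trans (sym (does-∈?-subsetOf P? k)) (dec-true (k ∈? _) k∈)))
  (λ Pk → does≡true⇒ (k ∈? _) (trans (does-∈?-subsetOf P? k) (dec-true (P? k) Pk)))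

weight-subsetOf : ∀ {n} {P : Pred (Fin n) 0ℓ} (P? : Decidable P) v →
                  weight v (subsetOf P?) ≡ sumWhere (λ k → does (P? k)) v
weight-subsetOf P? = sumWhere-cong (does-∈?-subsetOf P?)

weight-⊥ : ∀ {n} (v : Fin n → ℚ) → weight v ⊥ ≡ 0ℚ
weight-⊥ {n} v = trans (sumWhere-cong (λ k → dec-false (k ∈? ⊥) ∉⊥) v) (sumFin-zero n)

weight-⊤ : ∀ {n} (v : Fin n → ℚ) → weight v ⊤ ≡ sumFin v
weight-⊤ v = sumFin-cong (λ k → cong (λ x → if x then v k else 0ℚ) (dec-true (k ∈? ⊤) ∈⊤))

weight-─ : ∀ {n} v {R S : Subset n} → S ⊆ R → weight v R ≡ weight v S + weight v (R ─ S)
weight-─ v {R} {S} S⊆R = begin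
  weight v R
    ≡⟨ sumWhere-split (λ k → does (k ∈? R)) (λ k → does (k ∈? S)) v ⟩
  sumWhere (λ k → does (k ∈? R) ∧ does (k ∈? S)) v +
  sumWhere (λ k → does (k ∈? R) ∧ not (does (k ∈? S))) v
    ≡⟨ cong₂ _+_ (sumWhere-cong inside-S v) (sumWhere-cong (λ k → sym (does-∈?-─ k R S)) v) ⟩
  weight v S + weight v (R ─ S) ∎
  where
  open ≡-Reasoning
  inside-S : ∀ k → does (k ∈? R) ∧ does (k ∈? S) ≡ does (k ∈? S)
  inside-S k with k ∈? S
  ... | yes k∈S = cong (_∧ true) (dec-true (k ∈? R) (S⊆R k∈S))
  ... | no  _   = ∧-zeroʳ _

size-ℚ : ∀ {n} (S : Subset n) → ℕtoℚ (size S) ≡ weight (λ _ → 1ℚ) S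
size-ℚ S = trans (cong ℕtoℚ (size≡countFin S)) (countFin-ℚ (λ k → does (k ∈? S)))
  where
  size≡countFin : ∀ {n} (S : Subset n) → size S ≡ countFin (λ k → does (k ∈? S))
  size≡countFin []            = refl
  size≡countFin (inside  ∷ S) = cong suc (size≡countFin S)
  size≡countFin (outside ∷ S) = size≡countFin S

size-*-density : ∀ {n} (w : Fin n → ℚ) {j S} → j ∈ S → ℕtoℚ (size S) * density w S ≡ weight w S
size-*-density w {S = S} j∈S =
  ℕtoℚ-*-invℕ (weight w S) (size S) (ℕ.≤-<-trans ℕ.z≤n (x∈p⇒∣p-x∣<∣p∣ j∈S))

-- IsSubtree par r S is r ∈ S × ParentClosedExcept par r S.
ParentClosedExcept : ∀ {n} → (Fin n → Maybe (Fin n)) → Fin n → Subset n → Set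
ParentClosedExcept par r S = ∀ k → k ∈ S → k ≢ r → Σ _ λ p → par k ≡ just p × p ∈ S

ChildClosed : ∀ {n} → (Fin n → Maybe (Fin n)) → Subset n → Set
ChildClosed par R = ∀ {k p} → par k ≡ just p → p ∈ R → k ∈ R

root-parent-∉ : ∀ {n} (par : Fin n → Maybe (Fin n)) {r R} →
                (par r ≡ nothing ⊎ Σ _ λ p → par r ≡ just p × p ∉ R) →
                ∀ {p} → par r ≡ just p → p ∉ R
root-parent-∉ par (inj₁ r→∅)               r→p = contradiction (trans (sym r→∅) r→p) λ ()
root-parent-∉ par (inj₂ (p′ , r→p′ , p′∉R)) r→p =
  subst (_∉ _) (just-injective (trans (sym r→p′) r→p)) p′∉R

module _ {n} {par : Fin n → Maybe (Fin n)} (σ : Fin n → ℕ)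
         (parent-first : ∀ k p → par k ≡ just p → σ p < σ k) where

  no-parent-closed-set : (S : Pred (Fin n) 0ℓ) → (∀ {k} → S k → Σ _ λ p → par k ≡ just p × S p) →
                         ∀ k → ¬ S k
  no-parent-closed-set S closed k = descend k (<-wellFounded (σ k))
    where
    descend : ∀ k → Acc _<_ (σ k) → ¬ S k
    descend k (acc smaller) Sk with closed Sk
    ... | p , k→p , Sp = descend p (smaller (parent-first k p k→p)) Sp

  parentClosedExcept-∉⇒⊥ : ∀ {r S} → ParentClosedExcept par r S → r ∉ S → S ≡ ⊥
  parentClosedExcept-∉⇒⊥ {r} {S} closed r∉S = Empty-unique λ (k , k∈S) →
    no-parent-closed-set (_∈ S) (λ {k} k∈S → closed k k∈S (λ { refl → r∉S k∈S })) k k∈S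

  subtree⊆childClosed : ∀ {r S R} → ChildClosed par R → r ∈ R → IsSubtree par r S → S ⊆ R
  subtree⊆childClosed {r} {S} {R} childClosed r∈R (_ , closed) {k} k∈S with k ∈? R
  ... | yes k∈R = k∈R
  ... | no  k∉R = contradiction (k∈S , k∉R) (no-parent-closed-set (λ k → k ∈ S × k ∉ R) escape k)
    where
    escape : ∀ {k} → k ∈ S × k ∉ R → Σ _ λ p → par k ≡ just p × (p ∈ S × p ∉ R)
    escape {k} (k∈S , k∉R) with closed k k∈S (λ { refl → k∉R r∈R })
    ... | p , k→p , p∈S = p , k→p , p∈S , λ p∈R → k∉R (childClosed k→p p∈R)

  childClosed-─ : ∀ {r S R} → ChildClosed par R → IsSubtree par r S →
                  (∀ {p} → par r ≡ just p → p ∉ R) → ChildClosed par (R ─ S)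
  childClosed-─ {r} {S} {R} childClosed (_ , closed) root-parent∉R {k} {p} k→p p∈R─S =
    x∈p∧x∉q⇒x∈p─q (childClosed k→p p∈R) k∉S
    where
    p∈R : p ∈ R
    p∈R = p─q⊆p R S p∈R─S
    k∉S : k ∉ S
    k∉S k∈S with k ≟ r
    ... | yes refl = root-parent∉R k→p p∈R
    ... | no k≢r with closed k k∈S k≢r
    ...   | p′ , k→p′ , p′∈S =
      x∈p─q⇒x∉q R S p∈R─S (subst (_∈ S) (just-injective (trans (sym k→p′) k→p)) p′∈S)

  hornTrees-partition : ∀ {F : Fin n → Subset n} → (∀ j → IsSubtree par j (F j)) → ∀ v {R js} →
                        HornRun par F R js → ChildClosed par R →
                        sumList (λ j → weight v (F j)) js ≡ weight v R
  hornTrees-partition subtree v (done refl) _ = sym (weight-⊥ v)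
  hornTrees-partition {F} subtree v {R} (step {j = j} {js} j∈R root-parent run) childClosed = begin
    weight v (F j) + sumList (λ j → weight v (F j)) js
      ≡⟨ cong (weight v (F j) +_) (hornTrees-partition subtree v run childClosed′) ⟩
    weight v (F j) + weight v (R ─ F j)
      ≡⟨ weight-─ v (subtree⊆childClosed childClosed j∈R (subtree j)) ⟨
    weight v R ∎
    where
    open ≡-Reasoning
    childClosed′ : ChildClosed par (R ─ F j)
    childClosed′ = childClosed-─ childClosed (subtree j) (root-parent-∉ par root-parent)

module _ {n} {par : Fin n → Maybe (Fin n)} {w : Fin n → ℚ} {F : Fin n → Subset n}
         (maxDensity : IsMaxDensityChoice par w F) (σ : Fin n → ℕ)
         (parent-first : ∀ k p → par k ≡ just p → σ p < σ k) where

  parentClosedExcept-weight≤ : ∀ {j S} → ParentClosedExcept par j S →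
                               weight w S ≤ ℕtoℚ (size S) * density w (F j)
  parentClosedExcept-weight≤ {j} {S} closed with j ∈? S
  ... | yes j∈S = begin
    weight w S                      ≡⟨ size-*-density w j∈S ⟨
    ℕtoℚ (size S) * density w S     ≤⟨ ℚ.*-monoˡ-≤-nonNeg (ℕtoℚ (size S)) {{ℕtoℚ-nonNeg (size S)}}
                                         (proj₂ (maxDensity j) S (j∈S , closed)) ⟩
    ℕtoℚ (size S) * density w (F j) ∎
    where open ℚ.≤-Reasoning
  ... | no j∉S rewrite parentClosedExcept-∉⇒⊥ σ parent-first closed j∉S = ℚ.≤-reflexive (begin
    weight w ⊥                          ≡⟨ weight-⊥ w ⟩
    0ℚ                                  ≡⟨ ℚ.*-zeroˡ (density w (F j)) ⟨
    ℕtoℚ 0 * density w (F j)            ≡⟨ cong (λ s → ℕtoℚ s * density w (F j)) (∣⊥∣≡0 n) ⟨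
    ℕtoℚ (size (⊥ {n})) * density w (F j) ∎)
    where open ≡-Reasoning

  processedBefore? : (j : Fin n) (t : ℕ) → Decidable (λ k → k ∈ F j × ¬ t ℕ.≤ σ k)
  processedBefore? j t k = k ∈? F j ×-dec ¬? (t ℕ.≤? σ k)

  processedBefore : Fin n → ℕ → Subset n
  processedBefore j t = subsetOf (processedBefore? j t)

  processedBefore-closed : ∀ j t → ParentClosedExcept par j (processedBefore j t)
  processedBefore-closed j t k k∈A k≢j with Equivalence.to (∈-subsetOf (processedBefore? j t)) k∈A
  ... | k∈T , t≰σk with proj₂ (proj₁ (maxDensity j)) k k∈T k≢j
  ... | p , k→p , p∈T = p , k→p , Equivalence.from (∈-subsetOf (processedBefore? j t))
          (p∈T , λ t≤σp → t≰σk (ℕ.≤-trans t≤σp (ℕ.<⇒≤ (parent-first k p k→p))))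

  unprocessed-bound : ∀ j t → ℕtoℚ (unprocessed σ (F j) t) * density w (F j) ≤
                              sumWhere (λ k → does (k ∈? F j) ∧ does (t ℕ.≤? σ k)) w
  unprocessed-bound j t = +-cancelʳ-≤ (a * ρ) (begin
    u * ρ + a * ρ                   ≡⟨ ℚ.*-distribʳ-+ ρ u a ⟨
    (u + a) * ρ                     ≡⟨ cong (_* ρ) split-size ⟨
    ℕtoℚ (size (F j)) * ρ           ≡⟨ size-*-density w j∈T ⟩
    weight w (F j)                  ≡⟨ split w ⟩
    unprocessedWeight + weight w A  ≤⟨ ℚ.+-monoʳ-≤ unprocessedWeight
                                         (parentClosedExcept-weight≤ (processedBefore-closed j t)) ⟩
    unprocessedWeight + a * ρ       ∎)
    where
    open ℚ.≤-Reasoning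
    A : Subset n
    A = processedBefore j t
    later : Fin n → Bool
    later k = does (k ∈? F j) ∧ does (t ℕ.≤? σ k)
    ρ u a unprocessedWeight : ℚ
    ρ = density w (F j)
    u = ℕtoℚ (unprocessed σ (F j) t)
    a = ℕtoℚ (size A)
    unprocessedWeight = sumWhere later w
    j∈T : j ∈ F j
    j∈T = proj₁ (proj₁ (maxDensity j))
    split : ∀ v → weight v (F j) ≡ sumWhere later v + weight v A
    split v = trans (sumWhere-split (λ k → does (k ∈? F j)) (λ k → does (t ℕ.≤? σ k)) v)
                    (cong (sumWhere later v +_) (sym (weight-subsetOf (processedBefore? j t) v)))
    split-size : ℕtoℚ (size (F j)) ≡ u + a
    split-size = trans (size-ℚ (F j))
                       (trans (split (λ _ → 1ℚ)) (sym (cong₂ _+_ (countFin-ℚ later) (size-ℚ A))))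

  tree-bound : ∀ j → sumSteps (maxFin σ) (λ t → ℕtoℚ (unprocessed σ (F j) t) * density w (F j)) ≤
                     weight (λ k → w k * ℕtoℚ (σ k)) (F j)
  tree-bound j = ℚ.≤-trans (sumSteps-mono (maxFin σ) (unprocessed-bound j))
                           (ℚ.≤-reflexive (layer-cake (maxFin σ) σ (maxFin-upperBound σ)
                                                      (λ k → does (k ∈? F j)) w))

lemma11 : (n P : ℕ) (par : Fin n → Maybe (Fin n)) → Acyclic par →
          (w : Fin n → ℚ) → (∀ j → 0ℚ ≤ w j) →
          (F : Fin n → Subset n) → IsMaxDensityChoice par w F →
          (roots : List (Fin n)) → HornRun par F ⊤ roots →
          (σ : Fin n → ℕ) → Feasible P par σ →
          costf w (map F roots) σ ≤ cost w σ
lemma11 n P par _ w _ F maxDensity roots run σ (_ , _ , parent-first) = begin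
  costf w (map F roots) σ
    ≡⟨ sumSteps-sumList M fractional (map F roots) ⟩
  sumList (λ T → sumSteps M (fractional T)) (map F roots)
    ≡⟨ sumList-map (λ T → sumSteps M (fractional T)) F roots ⟩
  sumList (λ j → sumSteps M (fractional (F j))) roots
    ≤⟨ sumList-mono (tree-bound maxDensity σ parent-first) roots ⟩
  sumList (λ j → weight g (F j)) roots
    ≡⟨ hornTrees-partition σ parent-first (proj₁ ∘ maxDensity) g run (λ _ _ → ∈⊤) ⟩
  weight g ⊤
    ≡⟨ weight-⊤ g ⟩
  cost w σ ∎
  where
  open ℚ.≤-Reasoning
  M : ℕ
  M = maxFin σ
  fractional : Subset n → ℕ → ℚ
  fractional T t = ℕtoℚ (unprocessed σ T t) * density w T
  g : Fin n → ℚ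
  g k = w k * ℕtoℚ (σ k)
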